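{- For any decorated permutation $\sigma$ of $[n]$ with $k$ weak exceedances, $$A_+(\sigma)+A_-(\sigma)+C_+(\sigma)+C_-(\sigma)+A_{+,- }(\sigma)+|\{j : j>\sigma(j)\}|=(n-k)k.$$
   Context: A decorated permutation of $[n]$ is a permutation $\sigma$ of $[n]$ in which each fixed point is colored $+$ or $-$. Write $i\le_+\sigma(i)$ if $i<\sigma(i)$, or $i=\sigma(i)$ and $i$ is colored $+$; write $i\ge_-\sigma(i)$ if $i>\sigma(i)$, or $i=\sigma(i)$ and $i$ is colored $-$. For $i\in[n]$ let $A_+(i)=\{j : j<i,\ i\le_+\sigma(i),\ \sigma(i)<\sigma(j)\}$, $A_-(i)=\{j: j>i,\ i\ge_-\sigma(i),\ \sigma(i)>\sigma(j)\}$, $A_{+,- }(i)=\{j : i\ge_-\sigma(i),\ \sigma(i)>\sigma(j),\ j\le_+\sigma(j)\}\cup\{j : j\le_+\sigma(j),\ j>i,\ i\ge_-\sigma(i)\}$, $C_+(i)=\{j : i<j\le\sigma(i)<\sigma(j)\}$, $C_-(i)=\{j : j>i>\sigma(j)>\sigma(i)\}$, and for each of these set $X(\sigma)=\sum_{i=1}^n|X(i)|$. The number of weak exceedances is $|\{i : i\le_+\sigma(i)\}|$. -}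

module Defs where

open import Data.Nat using (ℕ; zero; suc; _+_; _*_; _∸_; _<ᵇ_; _≡ᵇ_)
open import Data.Bool using (Bool; true; false; _∧_; _∨_; not; if_then_else_)
open import Data.Fin using (Fin; toℕ)
open import Data.Fin.Permutation using (Permutation′; _⟨$⟩ʳ_)
open import Data.List using (List; map; allFin)
open import Data.Nat.ListAction using (sum)

-- A decorated permutation of [n] = {0,…,n-1} (0-indexed via Fin n):
-- a permutation together with a colour for each point; the colour
-- (true = "+", false = "−") is only ever consulted at fixed points.
record DecPerm (n : ℕ) : Set where
  field
    perm   : Permutation′ n
    colour : Fin n → Bool

count : ∀ {n} → (Fin n → Bool) → ℕ
count {n} p = sum (map (λ i → if p i then 1 else 0) (allFin n))

module _ {n : ℕ} (d : DecPerm n) where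
  open DecPerm d

  σ : Fin n → ℕ
  σ i = toℕ (perm ⟨$⟩ʳ i)

  _≺_ : ℕ → ℕ → Bool
  a ≺ b = a <ᵇ b

  wex : Fin n → Bool
  wex i = (toℕ i ≺ σ i) ∨ ((toℕ i ≡ᵇ σ i) ∧ colour i)

  wdef : Fin n → Bool
  wdef i = (σ i ≺ toℕ i) ∨ ((toℕ i ≡ᵇ σ i) ∧ not (colour i))

  A₊ : Fin n → ℕ
  A₊ i = count (λ j → (toℕ j ≺ toℕ i) ∧ wex i ∧ (σ i ≺ σ j))

  A₋ : Fin n → ℕ
  A₋ i = count (λ j → (toℕ i ≺ toℕ j) ∧ wdef i ∧ (σ j ≺ σ i))

  A₊₋ : Fin n → ℕ
  A₊₋ i = count (λ j → (wdef i ∧ (σ j ≺ σ i) ∧ wex j)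
                      ∨ (wex j ∧ (toℕ i ≺ toℕ j) ∧ wdef i))

  C₊ : Fin n → ℕ
  C₊ i = count (λ j → (toℕ i ≺ toℕ j) ∧ not (σ i ≺ toℕ j) ∧ (σ i ≺ σ j))

  C₋ : Fin n → ℕ
  C₋ i = count (λ j → (toℕ i ≺ toℕ j) ∧ (σ j ≺ toℕ i) ∧ (σ i ≺ σ j))

  total : (Fin n → ℕ) → ℕ
  total f = sum (map f (allFin n))

  weakExceedances : ℕ
  weakExceedances = count wex

  strictDeficiencies : ℕ
  strictDeficiencies = count (λ j → σ j ≺ toℕ j)

-- Each i is a weak exceedance or a weak deficiency, and only the statistics
-- of its own kind can be non-zero at i.  At an exceedance, A₊(i) + C₊(i)
-- counts the j ≤ σ(i) with σ(j) > σ(i); as many arcs j ↦ σ(j) cross the cut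
-- after σ(i) in each direction, so this is #{j > σ(i) : σ(j) < σ(i)}.  At a
-- deficiency the same balance at the cut before i gives
-- A₋(i) + C₋(i) + [σ(i) < i] = #{j < i ≤ σ(j)}, while A₊₋(i) is k minus the
-- number of exceedances j < i with σ(j) > σ(i).  Splitting the pairs
-- (deficiency i, exceedance j) with j < i and σ(i) < σ(j) according to
-- whether σ(j) ≥ i shows that these corrections cancel the exceedance terms,
-- leaving k for each of the n − k deficiencies.
module Submission where

open import Defs
open import Data.Bool using (Bool; true; false; _∧_; _∨_; not; if_then_else_; T)
open import Data.Bool.Properties using (T-∧; T-∨; T?; ∧-comm)
open import Data.Empty using (⊥-elim)
open import Data.Fin using (Fin; zero; suc; toℕ; punchIn)
open import Data.Fin.Permutation using (Permutation′; _⟨$⟩ʳ_; _⟨$⟩ˡ_; inverseˡ)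
open import Data.Fin.Properties using (toℕ-injective; punchInᵢ≢i)
open import Data.List using (map; allFin; tabulate)
open import Data.List.Properties using (map-tabulate)
open import Data.Nat using (ℕ; zero; suc; _+_; _*_; _∸_; _<ᵇ_; _≡ᵇ_; _<_; _≤_; _<?_; s≤s; s≤s⁻¹)
open import Data.Nat.ListAction using (sum)
open import Data.Nat.Properties
open import Algebra.Properties.Semiring.Sum +-*-semiring
  using (sum-syntax; sum-cong-≗; sum-remove; sum-permute; sum-replicate-zero; ∑-distrib-+; ∑-comm; *-distribʳ-sum)
open import Data.Nat.Tactic.RingSolver using (solve-∀)
open import Data.Product using (_×_; _,_; proj₁; proj₂)
open import Data.Product.Function.NonDependent.Propositional using (_×-⇔_)
open import Data.Sum using (_⊎_; inj₁; inj₂; [_,_]′)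
open import Data.Sum.Function.Propositional using (_⊎-⇔_)
open import Function using (_∘_; _⇔_; mk⇔; Equivalence)
open import Function.Construct.Composition using (_⇔-∘_)
open import Function.Construct.Identity using (⇔-id)
open import Function.Construct.Symmetry using (⇔-sym)
open import Relation.Binary using (tri<; tri≈; tri>)
open import Relation.Binary.PropositionalEquality using (_≡_; _≢_; refl; sym; trans; cong; cong₂; subst; module ≡-Reasoning)
open import Relation.Nullary using (¬_; yes; no)

open Equivalence using (to; from)
open ≡-Reasoning

𝟙 : Bool → ℕ
𝟙 b = if b then 1 else 0

_∧-⇔_ : ∀ {x y} {P Q : Set} → T x ⇔ P → T y ⇔ Q → T (x ∧ y) ⇔ (P × Q)
x⇔P ∧-⇔ y⇔Q = (x⇔P ×-⇔ y⇔Q) ⇔-∘ T-∧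

_∨-⇔_ : ∀ {x y} {P Q : Set} → T x ⇔ P → T y ⇔ Q → T (x ∨ y) ⇔ (P ⊎ Q)
x⇔P ∨-⇔ y⇔Q = (x⇔P ⊎-⇔ y⇔Q) ⇔-∘ T-∨

infixr 6 _∧-⇔_
infixr 5 _∨-⇔_

not-⇔ : ∀ {x} → T (not x) ⇔ (¬ T x)
not-⇔ {true}  = mk⇔ (λ ()) (λ ¬t → ¬t _)
not-⇔ {false} = mk⇔ (λ _ ()) _

<ᵇ-⇔ : ∀ {m n} → T (m <ᵇ n) ⇔ (m < n)
<ᵇ-⇔ = mk⇔ (<ᵇ⇒< _ _) <⇒<ᵇ

≮ᵇ-⇔ : ∀ {m n} → T (not (m <ᵇ n)) ⇔ (n ≤ m)
≮ᵇ-⇔ = mk⇔ (λ m≮n → ≮⇒≥ (m≮n ∘ <⇒<ᵇ)) (λ n≤m m<n → <⇒≱ (<ᵇ⇒< _ _ m<n) n≤m) ⇔-∘ not-⇔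

≡ᵇ-⇔ : ∀ {m n} → T (m ≡ᵇ n) ⇔ (m ≡ n)
≡ᵇ-⇔ = mk⇔ (≡ᵇ⇒≡ _ _) (≡⇒≡ᵇ _ _)

𝟙-false : ∀ {b} → ¬ T b → 𝟙 b ≡ 0
𝟙-false {true}  ¬t = ⊥-elim (¬t _)
𝟙-false {false} _  = refl

𝟙-true : ∀ {b} → T b → 𝟙 b ≡ 1
𝟙-true {true} _ = refl

𝟙-cong : ∀ {b c} → T b ⇔ T c → 𝟙 b ≡ 𝟙 c
𝟙-cong {true}  {true}  _   = refl
𝟙-cong {true}  {false} b⇔c = ⊥-elim (to b⇔c _)
𝟙-cong {false} {true}  b⇔c = ⊥-elim (from b⇔c _)
𝟙-cong {false} {false} _   = refl

𝟙-⊎ : ∀ {r p q} → T r ⇔ (T p ⊎ T q) → (T p → ¬ T q) → 𝟙 r ≡ 𝟙 p + 𝟙 q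
𝟙-⊎ {_}     {true}  {true}  _   disjoint = ⊥-elim (disjoint _ _)
𝟙-⊎ {true}  {true}  {false} _   _        = refl
𝟙-⊎ {true}  {false} {true}  _   _        = refl
𝟙-⊎ {true}  {false} {false} r⇔p⊎q _ with to r⇔p⊎q _
... | inj₁ ()
... | inj₂ ()
𝟙-⊎ {false} {true}  {false} r⇔p⊎q _ = ⊥-elim (from r⇔p⊎q (inj₁ _))
𝟙-⊎ {false} {false} {true}  r⇔p⊎q _ = ⊥-elim (from r⇔p⊎q (inj₂ _))
𝟙-⊎ {false} {false} {false} _     _ = refl

𝟙-split : ∀ c b → 𝟙 b ≡ 𝟙 (c ∧ b) + 𝟙 (not c ∧ b)
𝟙-split true  b = sym (+-identityʳ (𝟙 b))
𝟙-split false b = refl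

sum-map-allFin : ∀ {n} (f : Fin n → ℕ) → sum (map f (allFin n)) ≡ ∑[ i < n ] f i
sum-map-allFin f = trans (cong sum (map-tabulate (λ i → i) f)) (sum-tabulate f)
  where
  sum-tabulate : ∀ {n} (g : Fin n → ℕ) → sum (tabulate g) ≡ ∑[ i < n ] g i
  sum-tabulate {zero}  g = refl
  sum-tabulate {suc n} g = cong (g zero +_) (sum-tabulate (g ∘ suc))

module _ {n : ℕ} where

  count≡∑ : (p : Fin n → Bool) → count p ≡ ∑[ j < n ] 𝟙 (p j)
  count≡∑ p = sum-map-allFin (𝟙 ∘ p)

  count-+ : {r p q : Fin n → Bool} → (∀ j → 𝟙 (r j) ≡ 𝟙 (p j) + 𝟙 (q j)) →
            count r ≡ count p + count q
  count-+ {r} {p} {q} pointwise = begin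
    count r                                   ≡⟨ count≡∑ r ⟩
    ∑[ j < n ] 𝟙 (r j)                        ≡⟨ sum-cong-≗ pointwise ⟩
    ∑[ j < n ] (𝟙 (p j) + 𝟙 (q j))            ≡⟨ ∑-distrib-+ (𝟙 ∘ p) (𝟙 ∘ q) ⟩
    ∑[ j < n ] 𝟙 (p j) + ∑[ j < n ] 𝟙 (q j)  ≡⟨ cong₂ _+_ (count≡∑ p) (count≡∑ q) ⟨
    count p + count q                         ∎

  count-split : (q p : Fin n → Bool) →
                count p ≡ count (λ j → q j ∧ p j) + count (λ j → not (q j) ∧ p j)
  count-split q p = count-+ λ j → 𝟙-split (q j) (p j)

  count-cong : {p q : Fin n → Bool} {P Q : Fin n → Set} →
               (∀ j → T (p j) ⇔ P j) → (∀ j → T (q j) ⇔ Q j) → (∀ j → P j ⇔ Q j) →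
               count p ≡ count q
  count-cong {p} {q} p⇔P q⇔Q P⇔Q = begin
    count p             ≡⟨ count≡∑ p ⟩
    ∑[ j < n ] 𝟙 (p j)  ≡⟨ sum-cong-≗ (λ j → 𝟙-cong (⇔-sym (q⇔Q j) ⇔-∘ (P⇔Q j ⇔-∘ p⇔P j))) ⟩
    ∑[ j < n ] 𝟙 (q j)  ≡⟨ count≡∑ q ⟨
    count q             ∎

  count-disjoint-union : {r p q : Fin n → Bool} {R P Q : Fin n → Set} →
    (∀ j → T (r j) ⇔ R j) → (∀ j → T (p j) ⇔ P j) → (∀ j → T (q j) ⇔ Q j) →
    (∀ j → R j ⇔ (P j ⊎ Q j)) → (∀ j → P j → ¬ Q j) →
    count r ≡ count p + count q
  count-disjoint-union r⇔R p⇔P q⇔Q R⇔P⊎Q disjoint = count-+ λ j →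
    𝟙-⊎ (⇔-sym (p⇔P j ⊎-⇔ q⇔Q j) ⇔-∘ (R⇔P⊎Q j ⇔-∘ r⇔R j))
        (λ t u → disjoint j (to (p⇔P j) t) (to (q⇔Q j) u))

  count-none : {p : Fin n → Bool} {P : Fin n → Set} →
               (∀ j → T (p j) ⇔ P j) → (∀ j → ¬ P j) → count p ≡ 0
  count-none {p} p⇔P none = begin
    count p             ≡⟨ count≡∑ p ⟩
    ∑[ j < n ] 𝟙 (p j)  ≡⟨ sum-cong-≗ (λ j → 𝟙-false (none j ∘ to (p⇔P j))) ⟩
    ∑[ j < n ] 0        ≡⟨ sum-replicate-zero n ⟩
    0                   ∎

  count-unique : {p : Fin n → Bool} {P : Fin n → Set} (i : Fin n) →
                 (∀ j → T (p j) ⇔ P j) → (∀ j → P j → j ≡ i) → count p ≡ 𝟙 (p i)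
  count-unique {p} i p⇔P unique = trans (count≡∑ p) (∑-unique n i (λ j → unique j ∘ to (p⇔P j)))
    where
    ∑-unique : ∀ m {p : Fin m → Bool} (i : Fin m) → (∀ j → T (p j) → j ≡ i) →
               ∑[ j < m ] 𝟙 (p j) ≡ 𝟙 (p i)
    ∑-unique (suc m) {p} i unique = begin
      ∑[ j < suc m ] 𝟙 (p j)                     ≡⟨ sum-remove {i = i} (𝟙 ∘ p) ⟩
      𝟙 (p i) + ∑[ j < m ] 𝟙 (p (punchIn i j))  ≡⟨ cong (𝟙 (p i) +_) (sum-cong-≗ punched) ⟩
      𝟙 (p i) + ∑[ j < m ] 0                     ≡⟨ cong (𝟙 (p i) +_) (sum-replicate-zero m) ⟩
      𝟙 (p i) + 0                                ≡⟨ +-identityʳ _ ⟩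
      𝟙 (p i)                                    ∎
      where
      punched : ∀ j → 𝟙 (p (punchIn i j)) ≡ 0
      punched j = 𝟙-false (punchInᵢ≢i i j ∘ unique (punchIn i j))

  count-partition : {p q : Fin n → Bool} → (∀ j → T (p j) ⊎ T (q j)) → (∀ j → T (p j) → ¬ T (q j)) →
                    count p + count q ≡ n
  count-partition {p} {q} cover disjoint = begin
    count p + count q       ≡⟨ count-+ {r = λ _ → true} (λ j → 𝟙-⊎ (mk⇔ (λ _ → cover j) _) (disjoint j)) ⟨
    count {n} (λ _ → true)  ≡⟨ count≡∑ _ ⟩
    ∑[ j < n ] 1            ≡⟨ ∑-ones n ⟩
    n                       ∎
    where
    ∑-ones : ∀ m → ∑[ j < m ] 1 ≡ m
    ∑-ones zero    = refl
    ∑-ones (suc m) = cong suc (∑-ones m)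

  𝟙*count : ∀ b (p : Fin n → Bool) → 𝟙 b * count p ≡ count (λ j → b ∧ p j)
  𝟙*count true  p = +-identityʳ (count p)
  𝟙*count false p = sym (count-none (λ _ → ⇔-id _) (λ _ ()))

  count-permute : (π : Permutation′ n) (p : Fin n → Bool) → count (λ j → p (π ⟨$⟩ʳ j)) ≡ count p
  count-permute π p = begin
    count (λ j → p (π ⟨$⟩ʳ j))   ≡⟨ count≡∑ _ ⟩
    ∑[ j < n ] 𝟙 (p (π ⟨$⟩ʳ j))  ≡⟨ sum-permute (𝟙 ∘ p) π ⟨
    ∑[ j < n ] 𝟙 (p j)           ≡⟨ count≡∑ p ⟨
    count p                      ∎

∑-count-comm : ∀ {m n} (p : Fin m → Fin n → Bool) →
               ∑[ i < m ] count (p i) ≡ ∑[ j < n ] count (λ i → p i j)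
∑-count-comm {m} {n} p = begin
  ∑[ i < m ] count (p i)           ≡⟨ sum-cong-≗ (λ i → count≡∑ (p i)) ⟩
  ∑[ i < m ] ∑[ j < n ] 𝟙 (p i j)  ≡⟨ ∑-comm (λ i j → 𝟙 (p i j)) ⟩
  ∑[ j < n ] ∑[ i < m ] 𝟙 (p i j)  ≡⟨ sum-cong-≗ (λ j → count≡∑ (λ i → p i j)) ⟨
  ∑[ j < n ] count (λ i → p i j)   ∎

-- Arcs of a permutation crossing a cut

module _ {n : ℕ} (π : Permutation′ n) (t : ℕ) where

  leavingᵇ enteringᵇ : Fin n → Bool
  leavingᵇ  j = not (toℕ (π ⟨$⟩ʳ j) <ᵇ t) ∧ (toℕ j <ᵇ t)
  enteringᵇ j = not (toℕ j <ᵇ t) ∧ (toℕ (π ⟨$⟩ʳ j) <ᵇ t)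

  Leaving Entering : Fin n → Set
  Leaving  j = t ≤ toℕ (π ⟨$⟩ʳ j) × toℕ j < t
  Entering j = t ≤ toℕ j × toℕ (π ⟨$⟩ʳ j) < t

  leaving-⇔ : ∀ j → T (leavingᵇ j) ⇔ Leaving j
  leaving-⇔ j = ≮ᵇ-⇔ ∧-⇔ <ᵇ-⇔

  entering-⇔ : ∀ j → T (enteringᵇ j) ⇔ Entering j
  entering-⇔ j = ≮ᵇ-⇔ ∧-⇔ <ᵇ-⇔

  count-leaving≡count-entering : count leavingᵇ ≡ count enteringᵇ
  count-leaving≡count-entering = +-cancelˡ-≡ (count staying) _ _ (begin
    count staying + count leavingᵇ   ≡⟨ count-split below′ below ⟨
    count below                      ≡⟨ count-permute π below ⟨
    count below′                     ≡⟨ count-split below below′ ⟩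
    count staying′ + count enteringᵇ  ≡⟨ cong (_+ count enteringᵇ) (count-cong (λ _ → ⇔-id _) (λ _ → ⇔-id _) swap) ⟩
    count staying + count enteringᵇ   ∎)
    where
    below below′ staying staying′ : Fin n → Bool
    below    j = toℕ j <ᵇ t
    below′   j = toℕ (π ⟨$⟩ʳ j) <ᵇ t
    staying  j = below′ j ∧ below j
    staying′ j = below j ∧ below′ j
    swap : ∀ j → T (staying′ j) ⇔ T (staying j)
    swap j = subst (λ b → T (staying′ j) ⇔ T b) (∧-comm (below j) (below′ j)) (⇔-id _)

-- Weak exceedances and weak deficiencies

module _ {n : ℕ} (d : DecPerm n) where
  open DecPerm d

  σ-injective : ∀ {i j} → σ d i ≡ σ d j → i ≡ j
  σ-injective {i} {j} σi≡σj = begin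
    i                        ≡⟨ inverseˡ perm ⟨
    perm ⟨$⟩ˡ (perm ⟨$⟩ʳ i)  ≡⟨ cong (perm ⟨$⟩ˡ_) (toℕ-injective σi≡σj) ⟩
    perm ⟨$⟩ˡ (perm ⟨$⟩ʳ j)  ≡⟨ inverseˡ perm ⟩
    j                        ∎

  σ-cong : ∀ {i j} → toℕ i ≡ toℕ j → σ d i ≡ σ d j
  σ-cong = cong (σ d) ∘ toℕ-injective

  wex-⇔ : ∀ i → T (wex d i) ⇔ (toℕ i < σ d i ⊎ toℕ i ≡ σ d i × T (colour i))
  wex-⇔ i = <ᵇ-⇔ ∨-⇔ ≡ᵇ-⇔ ∧-⇔ ⇔-id _

  wdef-⇔ : ∀ i → T (wdef d i) ⇔ (σ d i < toℕ i ⊎ toℕ i ≡ σ d i × ¬ T (colour i))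
  wdef-⇔ i = <ᵇ-⇔ ∨-⇔ ≡ᵇ-⇔ ∧-⇔ not-⇔

  wex⇒≤ : ∀ {i} → T (wex d i) → toℕ i ≤ σ d i
  wex⇒≤ {i} w with to (wex-⇔ i) w
  ... | inj₁ i<σi       = <⇒≤ i<σi
  ... | inj₂ (i≡σi , _) = ≤-reflexive i≡σi

  wdef⇒≥ : ∀ {i} → T (wdef d i) → σ d i ≤ toℕ i
  wdef⇒≥ {i} w with to (wdef-⇔ i) w
  ... | inj₁ σi<i       = <⇒≤ σi<i
  ... | inj₂ (i≡σi , _) = ≤-reflexive (sym i≡σi)

  <⇒wex : ∀ {i} → toℕ i < σ d i → T (wex d i)
  <⇒wex {i} = from (wex-⇔ i) ∘ inj₁

  >⇒wdef : ∀ {i} → σ d i < toℕ i → T (wdef d i)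
  >⇒wdef {i} = from (wdef-⇔ i) ∘ inj₁

  wex⇒¬wdef : ∀ {i} → T (wex d i) → ¬ T (wdef d i)
  wex⇒¬wdef {i} w w′ with to (wex-⇔ i) w | to (wdef-⇔ i) w′
  ... | inj₁ i<σi   | _             = <⇒≱ i<σi (wdef⇒≥ w′)
  ... | inj₂ _      | inj₁ σi<i     = <⇒≱ σi<i (wex⇒≤ w)
  ... | inj₂ (_ , c) | inj₂ (_ , ¬c) = ¬c c

  wex⊎wdef : ∀ i → T (wex d i) ⊎ T (wdef d i)
  wex⊎wdef i with <-cmp (toℕ i) (σ d i) | T? (colour i)
  ... | tri< i<σi _ _ | _     = inj₁ (<⇒wex i<σi)
  ... | tri> _ _ σi<i | _     = inj₂ (>⇒wdef σi<i)
  ... | tri≈ _ i≡σi _ | yes c = inj₁ (from (wex-⇔ i) (inj₂ (i≡σi , c)))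
  ... | tri≈ _ i≡σi _ | no ¬c = inj₂ (from (wdef-⇔ i) (inj₂ (i≡σi , ¬c)))

  count-wdef+count-wex : count (wdef d) + weakExceedances d ≡ n
  count-wdef+count-wex = count-partition (λ i → [ inj₂ , inj₁ ]′ (wex⊎wdef i)) (λ i w′ w → wex⇒¬wdef w w′)

  A₊ᵇ A₋ᵇ C₊ᵇ C₋ᵇ A₊₋ᵇ : Fin n → Fin n → Bool
  A₊ᵇ i j  = (toℕ j <ᵇ toℕ i) ∧ wex d i ∧ (σ d i <ᵇ σ d j)
  A₋ᵇ i j  = (toℕ i <ᵇ toℕ j) ∧ wdef d i ∧ (σ d j <ᵇ σ d i)
  C₊ᵇ i j  = (toℕ i <ᵇ toℕ j) ∧ not (σ d i <ᵇ toℕ j) ∧ (σ d i <ᵇ σ d j)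
  C₋ᵇ i j  = (toℕ i <ᵇ toℕ j) ∧ (σ d j <ᵇ toℕ i) ∧ (σ d i <ᵇ σ d j)
  A₊₋ᵇ i j = (wdef d i ∧ (σ d j <ᵇ σ d i) ∧ wex d j) ∨ (wex d j ∧ (toℕ i <ᵇ toℕ j) ∧ wdef d i)

  InA₊ InA₋ InC₊ InC₋ InA₊₋ : Fin n → Fin n → Set
  InA₊ i j  = toℕ j < toℕ i × T (wex d i) × σ d i < σ d j
  InA₋ i j  = toℕ i < toℕ j × T (wdef d i) × σ d j < σ d i
  InC₊ i j  = toℕ i < toℕ j × toℕ j ≤ σ d i × σ d i < σ d j
  InC₋ i j  = toℕ i < toℕ j × σ d j < toℕ i × σ d i < σ d j
  InA₊₋ i j = (T (wdef d i) × σ d j < σ d i × T (wex d j)) ⊎ (T (wex d j) × toℕ i < toℕ j × T (wdef d i))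

  A₊-⇔ : ∀ i j → T (A₊ᵇ i j) ⇔ InA₊ i j
  A₊-⇔ i j = <ᵇ-⇔ ∧-⇔ ⇔-id _ ∧-⇔ <ᵇ-⇔

  A₋-⇔ : ∀ i j → T (A₋ᵇ i j) ⇔ InA₋ i j
  A₋-⇔ i j = <ᵇ-⇔ ∧-⇔ ⇔-id _ ∧-⇔ <ᵇ-⇔

  C₊-⇔ : ∀ i j → T (C₊ᵇ i j) ⇔ InC₊ i j
  C₊-⇔ i j = <ᵇ-⇔ ∧-⇔ ≮ᵇ-⇔ ∧-⇔ <ᵇ-⇔

  C₋-⇔ : ∀ i j → T (C₋ᵇ i j) ⇔ InC₋ i j
  C₋-⇔ i j = <ᵇ-⇔ ∧-⇔ <ᵇ-⇔ ∧-⇔ <ᵇ-⇔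

  A₊₋-⇔ : ∀ i j → T (A₊₋ᵇ i j) ⇔ InA₊₋ i j
  A₊₋-⇔ i j = (⇔-id _ ∧-⇔ <ᵇ-⇔ ∧-⇔ ⇔-id _) ∨-⇔ (⇔-id _ ∧-⇔ <ᵇ-⇔ ∧-⇔ ⇔-id _)

  largerUpToᵇ smallerBeyondᵇ backArcOverᵇ invertedExceedanceᵇ : Fin n → Fin n → Bool
  largerUpToᵇ i j         = not (σ d i <ᵇ toℕ j) ∧ (σ d i <ᵇ σ d j)
  smallerBeyondᵇ i j      = (σ d i <ᵇ toℕ j) ∧ (σ d j <ᵇ σ d i)
  backArcOverᵇ i j        = (toℕ i <ᵇ toℕ j) ∧ (σ d j <ᵇ toℕ i)
  invertedExceedanceᵇ i j = wex d j ∧ (toℕ j <ᵇ toℕ i) ∧ (σ d i <ᵇ σ d j)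

  LargerUpTo SmallerBeyond BackArcOver InvertedExceedance : Fin n → Fin n → Set
  LargerUpTo i j         = toℕ j ≤ σ d i × σ d i < σ d j
  SmallerBeyond i j      = σ d i < toℕ j × σ d j < σ d i
  BackArcOver i j        = toℕ i < toℕ j × σ d j < toℕ i
  InvertedExceedance i j = T (wex d j) × toℕ j < toℕ i × σ d i < σ d j

  largerUpTo-⇔ : ∀ i j → T (largerUpToᵇ i j) ⇔ LargerUpTo i j
  largerUpTo-⇔ i j = ≮ᵇ-⇔ ∧-⇔ <ᵇ-⇔

  smallerBeyond-⇔ : ∀ i j → T (smallerBeyondᵇ i j) ⇔ SmallerBeyond i j
  smallerBeyond-⇔ i j = <ᵇ-⇔ ∧-⇔ <ᵇ-⇔

  backArcOver-⇔ : ∀ i j → T (backArcOverᵇ i j) ⇔ BackArcOver i j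
  backArcOver-⇔ i j = <ᵇ-⇔ ∧-⇔ <ᵇ-⇔

  invertedExceedance-⇔ : ∀ i j → T (invertedExceedanceᵇ i j) ⇔ InvertedExceedance i j
  invertedExceedance-⇔ i j = ⇔-id _ ∧-⇔ <ᵇ-⇔ ∧-⇔ <ᵇ-⇔

  smallerBeyond arcsOver backArcsOver invertedExceedances : Fin n → ℕ
  smallerBeyond i       = count (smallerBeyondᵇ i)
  arcsOver i            = count (leavingᵇ perm (toℕ i))
  backArcsOver i        = count (backArcOverᵇ i)
  invertedExceedances i = count (invertedExceedanceᵇ i)

  backArcsOver+deficiency≡arcsOver : ∀ i → backArcsOver i + 𝟙 (σ d i <ᵇ toℕ i) ≡ arcsOver i
  backArcsOver+deficiency≡arcsOver i = begin
    backArcsOver i + 𝟙 (σ d i <ᵇ toℕ i)  ≡⟨ cong (backArcsOver i +_) (𝟙-cong fixed) ⟨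
    backArcsOver i + 𝟙 (selfᵇ i)          ≡⟨ cong (backArcsOver i +_) (count-unique i self-⇔ (λ _ → toℕ-injective ∘ proj₁)) ⟨
    backArcsOver i + count selfᵇ          ≡⟨ count-disjoint-union (entering-⇔ perm (toℕ i)) (backArcOver-⇔ i) self-⇔
                                               (λ _ → mk⇔ split join) disjoint ⟨
    count (enteringᵇ perm (toℕ i))        ≡⟨ count-leaving≡count-entering perm (toℕ i) ⟨
    arcsOver i                            ∎
    where
    selfᵇ : Fin n → Bool
    selfᵇ j = (toℕ j ≡ᵇ toℕ i) ∧ (σ d j <ᵇ toℕ i)

    Self : Fin n → Set
    Self j = toℕ j ≡ toℕ i × σ d j < toℕ i

    self-⇔ : ∀ j → T (selfᵇ j) ⇔ Self j
    self-⇔ j = ≡ᵇ-⇔ ∧-⇔ <ᵇ-⇔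

    fixed : T (selfᵇ i) ⇔ T (σ d i <ᵇ toℕ i)
    fixed = ⇔-sym <ᵇ-⇔ ⇔-∘ (mk⇔ proj₂ (refl ,_) ⇔-∘ self-⇔ i)

    split : ∀ {j} → Entering perm (toℕ i) j → BackArcOver i j ⊎ Self j
    split (i≤j , σj<i) = [ (λ i<j → inj₁ (i<j , σj<i)) , (λ i≡j → inj₂ (sym i≡j , σj<i)) ]′ (m≤n⇒m<n∨m≡n i≤j)

    join : ∀ {j} → BackArcOver i j ⊎ Self j → Entering perm (toℕ i) j
    join = [ (λ (i<j , σj<i) → <⇒≤ i<j , σj<i) , (λ (j≡i , σj<i) → ≤-reflexive (sym j≡i) , σj<i) ]′

    disjoint : ∀ j → BackArcOver i j → ¬ Self j
    disjoint _ (i<j , _) (j≡i , _) = <-irrefl (sym j≡i) i<j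

  contribution : Fin n → ℕ
  contribution i = A₊ d i + A₋ d i + C₊ d i + C₋ d i + A₊₋ d i + 𝟙 (σ d i <ᵇ toℕ i)

  module AtExceedance {i : Fin n} (w : T (wex d i)) where

    A₋≡0 : A₋ d i ≡ 0
    A₋≡0 = count-none (A₋-⇔ i) λ _ (_ , w′ , _) → wex⇒¬wdef w w′

    C₋≡0 : C₋ d i ≡ 0
    C₋≡0 = count-none (C₋-⇔ i) λ _ (_ , σj<i , σi<σj) → <⇒≱ (<-trans σi<σj σj<i) (wex⇒≤ w)

    A₊₋≡0 : A₊₋ d i ≡ 0
    A₊₋≡0 = count-none (A₊₋-⇔ i) λ _ → [ (λ (w′ , _) → wex⇒¬wdef w w′) , (λ (_ , _ , w′) → wex⇒¬wdef w w′) ]′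

    not-deficient : 𝟙 (σ d i <ᵇ toℕ i) ≡ 0
    not-deficient = 𝟙-false λ σi<i → <⇒≱ (to <ᵇ-⇔ σi<i) (wex⇒≤ w)

    A₊+C₊≡largerUpTo : A₊ d i + C₊ d i ≡ count (largerUpToᵇ i)
    A₊+C₊≡largerUpTo = sym (count-disjoint-union (largerUpTo-⇔ i) (A₊-⇔ i) (C₊-⇔ i) (λ j → mk⇔ (split j) join) disjoint)
      where
      split : ∀ j → LargerUpTo i j → InA₊ i j ⊎ InC₊ i j
      split j (j≤σi , σi<σj) with <-cmp (toℕ j) (toℕ i)
      ... | tri< j<i _ _ = inj₁ (j<i , w , σi<σj)
      ... | tri≈ _ j≡i _ = ⊥-elim (<-irrefl (sym (σ-cong j≡i)) σi<σj)
      ... | tri> _ _ i<j = inj₂ (i<j , j≤σi , σi<σj)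

      join : ∀ {j} → InA₊ i j ⊎ InC₊ i j → LargerUpTo i j
      join = [ (λ (j<i , _ , σi<σj) → ≤-trans (<⇒≤ j<i) (wex⇒≤ w) , σi<σj) , proj₂ ]′

      disjoint : ∀ j → InA₊ i j → ¬ InC₊ i j
      disjoint _ (j<i , _) (i<j , _) = <-asym j<i i<j

    largerUpTo≡smallerBeyond : count (largerUpToᵇ i) ≡ smallerBeyond i
    largerUpTo≡smallerBeyond = begin
      count (largerUpToᵇ i)    ≡⟨ count-cong (largerUpTo-⇔ i) (leaving-⇔ perm t)
                                             (λ _ → mk⇔ larger⇒leaving leaving⇒larger) ⟩
      count (leavingᵇ perm t)  ≡⟨ count-leaving≡count-entering perm t ⟩
      count (enteringᵇ perm t) ≡⟨ count-cong (entering-⇔ perm t) (smallerBeyond-⇔ i)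
                                             (λ j → mk⇔ (entering⇒beyond j) beyond⇒entering) ⟩
      smallerBeyond i          ∎
      where
      t : ℕ
      t = suc (σ d i)

      larger⇒leaving : ∀ {j} → LargerUpTo i j → Leaving perm t j
      larger⇒leaving (j≤σi , σi<σj) = σi<σj , s≤s j≤σi

      leaving⇒larger : ∀ {j} → Leaving perm t j → LargerUpTo i j
      leaving⇒larger (t≤σj , j<t) = s≤s⁻¹ j<t , t≤σj

      entering⇒beyond : ∀ j → Entering perm t j → SmallerBeyond i j
      entering⇒beyond j (σi<j , σj≤σi) = σi<j , ≤∧≢⇒< (s≤s⁻¹ σj≤σi) σj≢σi
        where
        σj≢σi : σ d j ≢ σ d i
        σj≢σi σj≡σi = <⇒≱ σi<j (≤-trans (≤-reflexive (cong toℕ (σ-injective σj≡σi))) (wex⇒≤ w))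

      beyond⇒entering : ∀ {j} → SmallerBeyond i j → Entering perm t j
      beyond⇒entering (σi<j , σj<σi) = σi<j , s≤s (<⇒≤ σj<σi)

    contribution≡smallerBeyond : contribution i ≡ smallerBeyond i
    contribution≡smallerBeyond = begin
      contribution i                             ≡⟨ cong₂ (λ a b → A₊ d i + a + C₊ d i + C₋ d i + A₊₋ d i + b) A₋≡0 not-deficient ⟩
      A₊ d i + 0 + C₊ d i + C₋ d i + A₊₋ d i + 0  ≡⟨ cong₂ (λ a b → A₊ d i + 0 + C₊ d i + a + b + 0) C₋≡0 A₊₋≡0 ⟩
      A₊ d i + 0 + C₊ d i + 0 + 0 + 0            ≡⟨ drop-zeros (A₊ d i) (C₊ d i) ⟩
      A₊ d i + C₊ d i                            ≡⟨ A₊+C₊≡largerUpTo ⟩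
      count (largerUpToᵇ i)                      ≡⟨ largerUpTo≡smallerBeyond ⟩
      smallerBeyond i                            ∎
      where
      drop-zeros : ∀ a c → a + 0 + c + 0 + 0 + 0 ≡ a + c
      drop-zeros = solve-∀

  module AtDeficiency {i : Fin n} (w : T (wdef d i)) where

    A₊≡0 : A₊ d i ≡ 0
    A₊≡0 = count-none (A₊-⇔ i) λ _ (_ , w′ , _) → wex⇒¬wdef w′ w

    C₊≡0 : C₊ d i ≡ 0
    C₊≡0 = count-none (C₊-⇔ i) λ _ (i<j , j≤σi , _) → <⇒≱ i<j (≤-trans j≤σi (wdef⇒≥ w))

    A₋+C₋≡backArcsOver : A₋ d i + C₋ d i ≡ backArcsOver i
    A₋+C₋≡backArcsOver = sym (count-disjoint-union (backArcOver-⇔ i) (A₋-⇔ i) (C₋-⇔ i) (λ j → mk⇔ (split j) join) disjoint)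
      where
      split : ∀ j → BackArcOver i j → InA₋ i j ⊎ InC₋ i j
      split j (i<j , σj<i) with <-cmp (σ d j) (σ d i)
      ... | tri< σj<σi _ _ = inj₁ (i<j , w , σj<σi)
      ... | tri≈ _ σj≡σi _ = ⊥-elim (<-irrefl (cong toℕ (sym (σ-injective σj≡σi))) i<j)
      ... | tri> _ _ σi<σj = inj₂ (i<j , σj<i , σi<σj)

      join : ∀ {j} → InA₋ i j ⊎ InC₋ i j → BackArcOver i j
      join = [ (λ (i<j , _ , σj<σi) → i<j , <-≤-trans σj<σi (wdef⇒≥ w)) , (λ (i<j , σj<i , _) → i<j , σj<i) ]′

      disjoint : ∀ j → InA₋ i j → ¬ InC₋ i j
      disjoint _ (_ , _ , σj<σi) (_ , _ , σi<σj) = <-asym σj<σi σi<σj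

    A₊₋+invertedExceedances≡weakExceedances : A₊₋ d i + invertedExceedances i ≡ weakExceedances d
    A₊₋+invertedExceedances≡weakExceedances =
      sym (count-disjoint-union (λ _ → ⇔-id _) (A₊₋-⇔ i) (invertedExceedance-⇔ i) (λ j → mk⇔ (split j) join) disjoint)
      where
      split : ∀ j → T (wex d j) → InA₊₋ i j ⊎ InvertedExceedance i j
      split j w′ with <-cmp (toℕ i) (toℕ j) | <-cmp (σ d j) (σ d i)
      ... | tri< i<j _ _ | _              = inj₁ (inj₂ (w′ , i<j , w))
      ... | tri≈ _ i≡j _ | _              = ⊥-elim (wex⇒¬wdef (subst (T ∘ wex d) (toℕ-injective (sym i≡j)) w′) w)
      ... | tri> _ _ j<i | tri< σj<σi _ _ = inj₁ (inj₁ (w , σj<σi , w′))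
      ... | tri> _ _ j<i | tri≈ _ σj≡σi _ = ⊥-elim (<-irrefl (cong toℕ (σ-injective σj≡σi)) j<i)
      ... | tri> _ _ j<i | tri> _ _ σi<σj = inj₂ (w′ , j<i , σi<σj)

      join : ∀ {j} → InA₊₋ i j ⊎ InvertedExceedance i j → T (wex d j)
      join = [ [ proj₂ ∘ proj₂ , proj₁ ]′ , proj₁ ]′

      disjoint : ∀ j → InA₊₋ i j → ¬ InvertedExceedance i j
      disjoint _ (inj₁ (_ , σj<σi , _)) (_ , _ , σi<σj) = <-asym σj<σi σi<σj
      disjoint _ (inj₂ (_ , i<j , _))   (_ , j<i , _)   = <-asym i<j j<i

    contribution+invertedExceedances : contribution i + invertedExceedances i ≡ arcsOver i + weakExceedances d
    contribution+invertedExceedances = begin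
      contribution i + invertedExceedances i
        ≡⟨ cong₂ (λ a c → a + A₋ d i + c + C₋ d i + A₊₋ d i + δ + invertedExceedances i) A₊≡0 C₊≡0 ⟩
      0 + A₋ d i + 0 + C₋ d i + A₊₋ d i + δ + invertedExceedances i
        ≡⟨ regroup (A₋ d i) (C₋ d i) (A₊₋ d i) δ (invertedExceedances i) ⟩
      (A₋ d i + C₋ d i + δ) + (A₊₋ d i + invertedExceedances i)
        ≡⟨ cong₂ _+_ (cong (_+ δ) A₋+C₋≡backArcsOver) A₊₋+invertedExceedances≡weakExceedances ⟩
      (backArcsOver i + δ) + weakExceedances d
        ≡⟨ cong (_+ weakExceedances d) (backArcsOver+deficiency≡arcsOver i) ⟩
      arcsOver i + weakExceedances d
        ∎
      where
      δ : ℕ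
      δ = 𝟙 (σ d i <ᵇ toℕ i)
      regroup : ∀ a c p δ r → 0 + a + 0 + c + p + δ + r ≡ (a + c + δ) + (p + r)
      regroup = solve-∀

  exceedancePairᵇ : Fin n → Fin n → Bool
  exceedancePairᵇ i j = wex d j ∧ smallerBeyondᵇ j i

  deficiency-pairs : ∀ i → 𝟙 (wdef d i) * invertedExceedances i ≡
                           𝟙 (wdef d i) * arcsOver i + count (exceedancePairᵇ i)
  deficiency-pairs i = begin
    𝟙 (wdef d i) * invertedExceedances i
      ≡⟨ 𝟙*count (wdef d i) (invertedExceedanceᵇ i) ⟩
    count (λ j → wdef d i ∧ invertedExceedanceᵇ i j)
      ≡⟨ count-disjoint-union (λ j → ⇔-id _ ∧-⇔ invertedExceedance-⇔ i j) (λ j → ⇔-id _ ∧-⇔ leaving-⇔ perm (toℕ i) j)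
                              (λ j → ⇔-id _ ∧-⇔ smallerBeyond-⇔ j i) (λ j → mk⇔ (split j) (join j)) disjoint ⟩
    count (λ j → wdef d i ∧ leavingᵇ perm (toℕ i) j) + count (exceedancePairᵇ i)
      ≡⟨ cong (_+ count (exceedancePairᵇ i)) (𝟙*count (wdef d i) (leavingᵇ perm (toℕ i))) ⟨
    𝟙 (wdef d i) * arcsOver i + count (exceedancePairᵇ i)
      ∎
    where
    split : ∀ j → T (wdef d i) × InvertedExceedance i j →
            (T (wdef d i) × Leaving perm (toℕ i) j) ⊎ (T (wex d j) × SmallerBeyond j i)
    split j (w , w′ , j<i , σi<σj) with σ d j <? toℕ i
    ... | yes σj<i = inj₂ (w′ , σj<i , σi<σj)
    ... | no  σj≮i = inj₁ (w , ≮⇒≥ σj≮i , j<i)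

    join : ∀ j → (T (wdef d i) × Leaving perm (toℕ i) j) ⊎ (T (wex d j) × SmallerBeyond j i) →
           T (wdef d i) × InvertedExceedance i j
    join j (inj₁ (w , i≤σj , j<i)) = w , <⇒wex (<-≤-trans j<i i≤σj) , j<i , ≤∧≢⇒< (≤-trans (wdef⇒≥ w) i≤σj) σi≢σj
      where
      σi≢σj : σ d i ≢ σ d j
      σi≢σj σi≡σj = <-irrefl (cong toℕ (sym (σ-injective σi≡σj))) j<i
    join j (inj₂ (w′ , σj<i , σi<σj)) = >⇒wdef (<-trans σi<σj σj<i) , w′ , ≤-<-trans (wex⇒≤ w′) σj<i , σi<σj

    disjoint : ∀ j → T (wdef d i) × Leaving perm (toℕ i) j → ¬ (T (wex d j) × SmallerBeyond j i)
    disjoint _ (_ , i≤σj , _) (_ , σj<i , _) = <⇒≱ σj<i i≤σj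

  double-count : ∑[ i < n ] (𝟙 (wdef d i) * invertedExceedances i) ≡
                 ∑[ i < n ] (𝟙 (wdef d i) * arcsOver i) + ∑[ j < n ] (𝟙 (wex d j) * smallerBeyond j)
  double-count = begin
    ∑[ i < n ] (𝟙 (wdef d i) * invertedExceedances i)     ≡⟨ sum-cong-≗ deficiency-pairs ⟩
    ∑[ i < n ] (𝟙 (wdef d i) * arcsOver i + count (exceedancePairᵇ i))
      ≡⟨ ∑-distrib-+ (λ i → 𝟙 (wdef d i) * arcsOver i) (count ∘ exceedancePairᵇ) ⟩
    crossings + ∑[ i < n ] count (exceedancePairᵇ i)     ≡⟨ cong (crossings +_) (∑-count-comm exceedancePairᵇ) ⟩
    crossings + ∑[ j < n ] count (λ i → exceedancePairᵇ i j)
      ≡⟨ cong (crossings +_) (sum-cong-≗ (λ j → 𝟙*count (wex d j) (smallerBeyondᵇ j))) ⟨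
    crossings + ∑[ j < n ] (𝟙 (wex d j) * smallerBeyond j) ∎
    where
    crossings : ℕ
    crossings = ∑[ i < n ] (𝟙 (wdef d i) * arcsOver i)

  weighted-contribution : ∀ i → contribution i + 𝟙 (wdef d i) * invertedExceedances i ≡
    𝟙 (wdef d i) * arcsOver i + 𝟙 (wex d i) * smallerBeyond i + 𝟙 (wdef d i) * weakExceedances d
  weighted-contribution i with wex⊎wdef i
  ... | inj₁ w = at-exceedance (𝟙-false {wdef d i} (wex⇒¬wdef w)) (𝟙-true {wex d i} w)
                               (AtExceedance.contribution≡smallerBeyond w)
    where
    at-exceedance : ∀ {a b c r y v k} → a ≡ 0 → b ≡ 1 → c ≡ v → c + a * r ≡ a * y + b * v + a * k
    at-exceedance {c = c} {r} {y} {v} {k} refl refl refl = shape c r y k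
      where
      shape : ∀ c r y k → c + 0 * r ≡ 0 * y + 1 * c + 0 * k
      shape = solve-∀
  ... | inj₂ w = at-deficiency (𝟙-true {wdef d i} w) (𝟙-false {wex d i} (λ w′ → wex⇒¬wdef w′ w))
                               (AtDeficiency.contribution+invertedExceedances w)
    where
    at-deficiency : ∀ {a b c r y v k} → a ≡ 1 → b ≡ 0 → c + r ≡ y + k → c + a * r ≡ a * y + b * v + a * k
    at-deficiency {c = c} {r} {y} {v} {k} refl refl c+r≡y+k = trans (shape₁ c r) (trans c+r≡y+k (shape₂ y v k))
      where
      shape₁ : ∀ c r → c + 1 * r ≡ c + r
      shape₁ = solve-∀
      shape₂ : ∀ y v k → y + k ≡ 1 * y + 0 * v + 1 * k
      shape₂ = solve-∀

  ∑-contribution : ∑[ i < n ] contribution i ≡ (n ∸ weakExceedances d) * weakExceedances d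
  ∑-contribution = begin
    ∑[ i < n ] contribution i             ≡⟨ +-cancelʳ-≡ (∑[ i < n ] inverted i) _ _ weighted-sums ⟩
    ∑[ i < n ] (𝟙 (wdef d i) * k)         ≡⟨ *-distribʳ-sum k (𝟙 ∘ wdef d) ⟨
    (∑[ i < n ] 𝟙 (wdef d i)) * k         ≡⟨ cong (_* k) (count≡∑ (wdef d)) ⟨
    count (wdef d) * k                    ≡⟨ cong (_* k) deficiencies ⟩
    (n ∸ k) * k                           ∎
    where
    k : ℕ
    k = weakExceedances d

    inverted crossing beyond : Fin n → ℕ
    inverted i = 𝟙 (wdef d i) * invertedExceedances i
    crossing i = 𝟙 (wdef d i) * arcsOver i
    beyond   i = 𝟙 (wex d i) * smallerBeyond i

    deficiencies : count (wdef d) ≡ n ∸ k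
    deficiencies = trans (sym (m+n∸n≡m (count (wdef d)) k)) (cong (_∸ k) count-wdef+count-wex)

    weighted-sums : ∑[ i < n ] contribution i + ∑[ i < n ] inverted i ≡
                    ∑[ i < n ] (𝟙 (wdef d i) * k) + ∑[ i < n ] inverted i
    weighted-sums = begin
      ∑[ i < n ] contribution i + ∑[ i < n ] inverted i            ≡⟨ ∑-distrib-+ contribution inverted ⟨
      ∑[ i < n ] (contribution i + inverted i)                     ≡⟨ sum-cong-≗ weighted-contribution ⟩
      ∑[ i < n ] (crossing i + beyond i + 𝟙 (wdef d i) * k)
        ≡⟨ ∑-distrib-+ (λ i → crossing i + beyond i) (λ i → 𝟙 (wdef d i) * k) ⟩
      ∑[ i < n ] (crossing i + beyond i) + ∑[ i < n ] (𝟙 (wdef d i) * k)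
        ≡⟨ cong (_+ ∑[ i < n ] (𝟙 (wdef d i) * k)) (trans (∑-distrib-+ crossing beyond) (sym double-count)) ⟩
      ∑[ i < n ] inverted i + ∑[ i < n ] (𝟙 (wdef d i) * k)        ≡⟨ +-comm (∑[ i < n ] inverted i) _ ⟩
      ∑[ i < n ] (𝟙 (wdef d i) * k) + ∑[ i < n ] inverted i        ∎

  statistics≡∑contribution :
    total d (A₊ d) + total d (A₋ d) + total d (C₊ d) + total d (C₋ d) + total d (A₊₋ d) + strictDeficiencies d
      ≡ ∑[ i < n ] contribution i
  statistics≡∑contribution
    rewrite sum-map-allFin (A₊ d) | sum-map-allFin (A₋ d) | sum-map-allFin (C₊ d) | sum-map-allFin (C₋ d)
          | sum-map-allFin (A₊₋ d) | count≡∑ (λ i → σ d i <ᵇ toℕ i)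
          | sym (∑-distrib-+ (A₊ d) (A₋ d))
          | sym (∑-distrib-+ (λ i → A₊ d i + A₋ d i) (C₊ d))
          | sym (∑-distrib-+ (λ i → A₊ d i + A₋ d i + C₊ d i) (C₋ d))
          | sym (∑-distrib-+ (λ i → A₊ d i + A₋ d i + C₊ d i + C₋ d i) (A₊₋ d))
          | sym (∑-distrib-+ (λ i → A₊ d i + A₋ d i + C₊ d i + C₋ d i + A₊₋ d i) (λ i → 𝟙 (σ d i <ᵇ toℕ i)))
    = refl

proposition8 : (n : ℕ) (d : DecPerm n) (k : ℕ) → weakExceedances d ≡ k →
    total d (A₊ d) + total d (A₋ d) + total d (C₊ d) + total d (C₋ d)
      + total d (A₊₋ d) + strictDeficiencies d ≡ (n ∸ k) * k
proposition8 n d _ refl = trans (statistics≡∑contribution d) (∑-contribution d)
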